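{- Let $k$ be a finite field. Every element $\delta\in k^\times/k^{\times12}$ is the discriminant of some elliptic curve over $k$.
   Context: The discriminant of an elliptic curve $E$ over $k$ is the class in $k^\times/k^{\times 12}$ of the discriminant $d_f=-b_2^2b_8-8b_4^3-27b_6^2+9b_2b_4b_6$ of any Weierstrass equation $y^2+a_1xy+a_3y=x^3+a_2x^2+a_4x+a_6$ defining $E$, where $b_2=a_1^2+4a_2$, $b_4=a_1a_3+2a_4$, $b_6=a_3^2+4a_6$, $b_8=b_2a_6-a_1a_3a_4+a_2a_3^2-a_4^2$; changing the Weierstrass equation multiplies $d_f$ by a twelfth power $u^{12}$, $u\in k^\times$. -}

module Defs where

open import Level using (_⊔_)
open import Algebra.Bundles using (CommutativeRing)
open import Data.Nat as ℕ using (ℕ; zero; suc)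
open import Data.Fin using (Fin)
open import Data.Product using (Σ; ∃; _×_; _,_)
open import Relation.Nullary using (¬_)
open import Relation.Binary.PropositionalEquality using (_≡_)

module _ {c ℓ} (R : CommutativeRing c ℓ) where
  open CommutativeRing R

  record IsField : Set (c ⊔ ℓ) where
    field
      1≉0     : ¬ (1# ≈ 0#)
      inverse : ∀ x → ¬ (x ≈ 0#) → ∃ λ y → (x * y) ≈ 1#

  record IsFinite : Set (c ⊔ ℓ) where
    field
      size    : ℕ
      enum    : Fin size → Carrier
      index   : Carrier → Fin size
      index-cong : ∀ {x y} → x ≈ y → index x ≡ index y
      enum-index : ∀ x → enum (index x) ≈ x
      index-enum : ∀ i → index (enum i) ≡ i

  ι : ℕ → Carrier
  ι zero    = 0#
  ι (suc n) = 1# + ι n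

  pow : Carrier → ℕ → Carrier
  pow x zero    = 1#
  pow x (suc n) = x * pow x n

  -- a (long) Weierstrass equation y²+a₁xy+a₃y = x³+a₂x²+a₄x+a₆
  record Weierstrass : Set c where
    constructor weierstrass
    field
      a₁ a₂ a₃ a₄ a₆ : Carrier

    b₂ b₄ b₆ b₈ : Carrier
    b₂ = a₁ * a₁ + ι 4 * a₂
    b₄ = a₁ * a₃ + ι 2 * a₄
    b₆ = a₃ * a₃ + ι 4 * a₆
    b₈ = b₂ * a₆ - a₁ * a₃ * a₄ + a₂ * a₃ * a₃ - a₄ * a₄

    disc : Carrier
    disc = - (b₂ * b₂ * b₈) - ι 8 * pow b₄ 3 - ι 27 * (b₆ * b₆) + ι 9 * b₂ * b₄ * b₆

  record EllipticCurve : Set (c ⊔ ℓ) where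
    field
      equation   : Weierstrass
      nonsingular : ¬ (Weierstrass.disc equation ≈ 0#)

  -- δ ∈ k^× represents the discriminant class of E in k^×/k^×¹²:
  -- d_f = δ · u¹² for some u ∈ k^×
  IsDiscriminantOf : Carrier → EllipticCurve → Set (c ⊔ ℓ)
  IsDiscriminantOf δ E =
    ∃ λ u → ¬ (u ≈ 0#) × (Weierstrass.disc (EllipticCurve.equation E) ≈ δ * pow u 12)

module Submission where

-- If 2 or 3 vanishes in k then 432 = 2⁴·3³ does, and y² + xy = x³ − δ has discriminant exactly δ.
-- Otherwise y² = x³ − 3sx + 2t has discriminant −1728(t² − s³), so it suffices that every curve
-- y² = x³ + c with c ≠ 0 has an affine point. Let N(c) count the points and q = |k|. Summing over c,
-- Σ N(c) = q² and Σ N(c)² = q³ − q² + qC, where C = #{(x, x′) : x³ = x′³} ≤ 3q − 2 (a cube has at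
-- most three cube roots, and 0 only one); the latter uses that y² − y′² = s has q − 1 + q·[s = 0]
-- solutions when 2 is invertible. Hence Σ (N(c) − q)² = qC − q² < 2q², so N vanishes for at most
-- one c. As (x, y) ↦ (l²x, l³y) carries the curve for c to that for l⁶c, a pointless c forces
-- l⁶ = 1 for all l ≠ 0, so c⁶ = 1; and for such c a point is read off the factors of c⁶ − 1.

open import Defs
open import Algebra.Bundles using (CommutativeRing; RawRing)
open import Data.Nat as ℕ using (ℕ; zero; suc)
open import Data.Product using (_×_; _,_; ∃)
open import Data.Sum as Sum using (_⊎_; inj₁; inj₂; [_,_]′)
open import Data.Empty using (⊥; ⊥-elim)
open import Data.Maybe using (Maybe; just; nothing)
open import Function using (_∘_)
open import Relation.Nullary using (¬_; Dec; yes; no)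
open import Relation.Binary.Core using (_Preserves_⟶_)
open import Relation.Binary.PropositionalEquality as ≡ using (_≡_; _≢_)

module IntegerCoefficientSolver {r ℓ} (R : CommutativeRing r ℓ) where
  open CommutativeRing R
  open import Algebra.Properties.Ring ring using (⁻¹-anti-homo‿-; -0#≈0#; -‿involutive; -‿anti-homo-+; -‿distribˡ-*; -‿distribʳ-*)
  open import Algebra.Properties.Semiring.Mult semiring using (×-homo-+; ×1-homo-*) renaming (_×_ to _×ᴿ_)
  open import Algebra.Solver.Ring.AlmostCommutativeRing using (fromCommutativeRing; _-Raw-AlmostCommutative⟶_)
  open import Algebra.Solver.CommutativeMonoid +-commutativeMonoid using (_⊕_; _⊜_) renaming (solve to solve₊)
  open import Relation.Binary.Reasoning.Setoid setoid

  ι≈×1# : ∀ n → ι R n ≈ n ×ᴿ 1#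
  ι≈×1# zero    = refl
  ι≈×1# (suc n) = +-congˡ (ι≈×1# n)

  ι-+ : ∀ m n → ι R (m ℕ.+ n) ≈ ι R m + ι R n
  ι-+ m n = begin
    ι R (m ℕ.+ n)        ≈⟨ ι≈×1# (m ℕ.+ n) ⟩
    (m ℕ.+ n) ×ᴿ 1#       ≈⟨ ×-homo-+ 1# m n ⟩
    m ×ᴿ 1# + n ×ᴿ 1#      ≈⟨ +-cong (ι≈×1# m) (ι≈×1# n) ⟨
    ι R m + ι R n        ∎

  ι-* : ∀ m n → ι R (m ℕ.* n) ≈ ι R m * ι R n
  ι-* m n = begin
    ι R (m ℕ.* n)        ≈⟨ ι≈×1# (m ℕ.* n) ⟩
    (m ℕ.* n) ×ᴿ 1#       ≈⟨ ×1-homo-* m n ⟩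
    m ×ᴿ 1# * n ×ᴿ 1#      ≈⟨ *-cong (ι≈×1# m) (ι≈×1# n) ⟨
    ι R m * ι R n        ∎

  -- The pair (m , n) codes the integer m − n. Sums and products are normalised so that one
  -- component is 0; equal integers then have equal codes and normal forms can be compared by
  -- refl. The code (m , 0) denotes ι m on the nose, so goals phrased with ι match the solver.
  ⟦_⟧ : ℕ × ℕ → Carrier
  ⟦ m , zero  ⟧ = ι R m
  ⟦ m , suc n ⟧ = ι R m - ι R (suc n)

  ⟦⟧≈ : ∀ m n → ⟦ m , n ⟧ ≈ ι R m - ι R n
  ⟦⟧≈ m zero    = sym (trans (+-congˡ -0#≈0#) (+-identityʳ (ι R m)))
  ⟦⟧≈ m (suc n) = refl

  [a+c]-[b+d]≈[a-b]+[c-d] : ∀ a b c d → (a + c) - (b + d) ≈ (a - b) + (c - d)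
  [a+c]-[b+d]≈[a-b]+[c-d] a b c d = begin
    (a + c) - (b + d)        ≈⟨ +-congˡ (-‿anti-homo-+ b d) ⟩
    (a + c) + (- d + - b)    ≈⟨ solve₊ 4 (λ a b c d → (a ⊕ c) ⊕ (d ⊕ b) ⊜ (a ⊕ b) ⊕ (c ⊕ d)) refl a (- b) c (- d) ⟩
    (a - b) + (c - d)        ∎

  [ac+bd]-[ad+bc]≈[a-b][c-d] : ∀ a b c d → (a * c + b * d) - (a * d + b * c) ≈ (a - b) * (c - d)
  [ac+bd]-[ad+bc]≈[a-b][c-d] a b c d = sym (begin
    (a - b) * (c - d)                         ≈⟨ distribʳ (c - d) a (- b) ⟩
    a * (c - d) + - b * (c - d)               ≈⟨ +-cong (distribˡ a c (- d)) (distribˡ (- b) c (- d)) ⟩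
    (a * c + a * - d) + (- b * c + - b * - d) ≈⟨ +-cong (+-congˡ (sym (-‿distribʳ-* a d))) (+-cong (sym (-‿distribˡ-* b c)) neg-neg) ⟩
    (a * c - a * d) + (- (b * c) + b * d)
      ≈⟨ solve₊ 4 (λ p q r s → (p ⊕ q) ⊕ (r ⊕ s) ⊜ (p ⊕ s) ⊕ (r ⊕ q)) refl (a * c) (- (a * d)) (- (b * c)) (b * d) ⟩
    (a * c + b * d) + (- (b * c) + - (a * d)) ≈⟨ +-congˡ (-‿anti-homo-+ (a * d) (b * c)) ⟨
    (a * c + b * d) - (a * d + b * c)         ∎)
    where
    neg-neg : - b * - d ≈ b * d
    neg-neg = trans (sym (-‿distribˡ-* b (- d))) (trans (-‿cong (sym (-‿distribʳ-* b d))) (-‿involutive (b * d)))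

  x+[y-y]≈x : ∀ x y → x + (y - y) ≈ x
  x+[y-y]≈x x y = trans (+-congˡ (-‿inverseʳ y)) (+-identityʳ x)

  a+d≈c+b⇒a-b≈c-d : ∀ {a b c d} → a + d ≈ c + b → a - b ≈ c - d
  a+d≈c+b⇒a-b≈c-d {a} {b} {c} {d} e = begin
    a - b                ≈⟨ x+[y-y]≈x (a - b) d ⟨
    (a - b) + (d - d)    ≈⟨ [a+c]-[b+d]≈[a-b]+[c-d] a b d d ⟨
    (a + d) - (b + d)    ≈⟨ +-cong e (-‿cong (+-comm b d)) ⟩
    (c + b) - (d + b)    ≈⟨ [a+c]-[b+d]≈[a-b]+[c-d] c d b b ⟩
    (c - d) + (b - b)    ≈⟨ x+[y-y]≈x (c - d) b ⟩
    c - d                ∎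

  normalise : ℕ → ℕ → ℕ × ℕ
  normalise m n = (m ℕ.∸ n , n ℕ.∸ m)

  ⟦normalise⟧ : ∀ m n → ⟦ normalise m n ⟧ ≈ ι R m - ι R n
  ⟦normalise⟧ m n = trans (⟦⟧≈ (m ℕ.∸ n) (n ℕ.∸ m)) (cancel m n)
    where
    cancel : ∀ m n → ι R (m ℕ.∸ n) - ι R (n ℕ.∸ m) ≈ ι R m - ι R n
    cancel zero    zero    = refl
    cancel zero    (suc n) = refl
    cancel (suc m) zero    = refl
    cancel (suc m) (suc n) = trans (cancel m n) (a+d≈c+b⇒a-b≈c-d (solve₊ 3 (λ o a b → a ⊕ (o ⊕ b) ⊜ (o ⊕ a) ⊕ b) refl 1# (ι R m) (ι R n)))

  ℕ²-rawRing : RawRing _ _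
  ℕ²-rawRing = record
    { Carrier = ℕ × ℕ
    ; _≈_ = _≡_
    ; _+_ = λ { (m , n) (p , r) → normalise (m ℕ.+ p) (n ℕ.+ r) }
    ; _*_ = λ { (m , n) (p , r) → normalise (m ℕ.* p ℕ.+ n ℕ.* r) (m ℕ.* r ℕ.+ n ℕ.* p) }
    ; -_  = λ { (m , n) → (n , m) }
    ; 0#  = (0 , 0)
    ; 1#  = (1 , 0)
    }

  ⟦⟧-homomorphism : ℕ²-rawRing -Raw-AlmostCommutative⟶ fromCommutativeRing R
  ⟦⟧-homomorphism = record
    { ⟦_⟧    = ⟦_⟧
    ; +-homo = λ { (m , n) (p , r) → begin
        ⟦ normalise (m ℕ.+ p) (n ℕ.+ r) ⟧         ≈⟨ ⟦normalise⟧ (m ℕ.+ p) (n ℕ.+ r) ⟩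
        ι R (m ℕ.+ p) - ι R (n ℕ.+ r)             ≈⟨ +-cong (ι-+ m p) (-‿cong (ι-+ n r)) ⟩
        (ι R m + ι R p) - (ι R n + ι R r)         ≈⟨ [a+c]-[b+d]≈[a-b]+[c-d] _ _ _ _ ⟩
        (ι R m - ι R n) + (ι R p - ι R r)         ≈⟨ +-cong (⟦⟧≈ m n) (⟦⟧≈ p r) ⟨
        ⟦ m , n ⟧ + ⟦ p , r ⟧                      ∎ }
    ; *-homo = λ { (m , n) (p , r) → begin
        ⟦ normalise (m ℕ.* p ℕ.+ n ℕ.* r) (m ℕ.* r ℕ.+ n ℕ.* p) ⟧ ≈⟨ ⟦normalise⟧ (m ℕ.* p ℕ.+ n ℕ.* r) (m ℕ.* r ℕ.+ n ℕ.* p) ⟩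
        ι R (m ℕ.* p ℕ.+ n ℕ.* r) - ι R (m ℕ.* r ℕ.+ n ℕ.* p) ≈⟨ +-cong (ι-+*  m p n r) (-‿cong (ι-+* m r n p)) ⟩
        (ι R m * ι R p + ι R n * ι R r) - (ι R m * ι R r + ι R n * ι R p) ≈⟨ [ac+bd]-[ad+bc]≈[a-b][c-d] _ _ _ _ ⟩
        (ι R m - ι R n) * (ι R p - ι R r)         ≈⟨ *-cong (⟦⟧≈ m n) (⟦⟧≈ p r) ⟨
        ⟦ m , n ⟧ * ⟦ p , r ⟧                      ∎ }
    ; -‿homo = λ { (m , n) → begin
        ⟦ n , m ⟧               ≈⟨ ⟦⟧≈ n m ⟩
        ι R n - ι R m           ≈⟨ ⁻¹-anti-homo‿- (ι R m) (ι R n) ⟨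
        - (ι R m - ι R n)       ≈⟨ -‿cong (⟦⟧≈ m n) ⟨
        - ⟦ m , n ⟧             ∎ }
    ; 0-homo = refl
    ; 1-homo = +-identityʳ 1#
    }
    where
    ι-+* : ∀ m p n r → ι R (m ℕ.* p ℕ.+ n ℕ.* r) ≈ ι R m * ι R p + ι R n * ι R r
    ι-+* m p n r = trans (ι-+ (m ℕ.* p) (n ℕ.* r)) (+-cong (ι-* m p) (ι-* n r))

  ⟦⟧-≟ : ∀ i j → Maybe (⟦ i ⟧ ≈ ⟦ j ⟧)
  ⟦⟧-≟ (m , n) (p , r) with m ℕ.+ r ℕ.≟ p ℕ.+ n
  ... | no _  = nothing
  ... | yes e = just (begin
    ⟦ m , n ⟧       ≈⟨ ⟦⟧≈ m n ⟩
    ι R m - ι R n   ≈⟨ a+d≈c+b⇒a-b≈c-d (trans (sym (ι-+ m r)) (trans (reflexive (≡.cong (ι R) e)) (ι-+ p n))) ⟩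
    ι R p - ι R r   ≈⟨ ⟦⟧≈ p r ⟨
    ⟦ p , r ⟧       ∎)

  open import Algebra.Solver.Ring ℕ²-rawRing (fromCommutativeRing R) ⟦⟧-homomorphism ⟦⟧-≟ public
    using (solve; _:=_; _:+_; _:*_; :-_; _:-_; _:^_; con; Polynomial)

module NatArithmetic where
  open import Data.Nat using (_≤_; _+_; _*_; NonZero)
  open import Data.Nat.Properties
    using (module ≤-Reasoning; +-cancelˡ-≤; *-cancelˡ-≤; +-monoˡ-≤; ≤-total; m≤n⇒∃[o]m+o≡n; m≤m+n; ≤-reflexive; ≤-trans; +-comm)
  open import Data.Nat.Tactic.RingSolver using (solve)
  open import Data.List using ([]; _∷_)

  private
    ordered : ∀ {m n} → m ≤ n → 2 * m * n ≤ m * m + n * n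
    ordered {m} m≤n with m≤n⇒∃[o]m+o≡n m≤n
    ... | d , ≡.refl = ≤-trans (m≤m+n (2 * m * (m + d)) (d * d)) (≤-reflexive (solve (m ∷ d ∷ [])))

  2*m*n≤m*m+n*n : ∀ m n → 2 * m * n ≤ m * m + n * n
  2*m*n≤m*m+n*n m n with ≤-total m n
  ... | inj₁ m≤n = ordered m≤n
  ... | inj₂ n≤m = begin
    2 * m * n      ≡⟨ solve (m ∷ n ∷ []) ⟩
    2 * n * m      ≤⟨ ordered n≤m ⟩
    n * n + m * m  ≡⟨ +-comm (n * n) (m * m) ⟩
    m * m + n * n  ∎
    where open ≤-Reasoning

  second-moment-bound : ∀ q e c .{{_ : NonZero q}} → e + q * q ≡ q * (q * q) + q * c →
                        2 * q * (q * q) + q * q * 2 ≤ e + q * (q * q) → q * 3 ≤ c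
  second-moment-bound q e c e+q²≡q³+qc lower = *-cancelˡ-≤ q (+-cancelˡ-≤ (q * (q * q) * 2) _ _ (begin
    q * (q * q) * 2 + q * (q * 3)        ≡⟨ solve (q ∷ []) ⟩
    2 * q * (q * q) + q * q * 2 + q * q  ≤⟨ +-monoˡ-≤ (q * q) lower ⟩
    e + q * (q * q) + q * q              ≡⟨ solve (e ∷ q ∷ []) ⟩
    (e + q * q) + q * (q * q)            ≡⟨ ≡.cong (_+ q * (q * q)) e+q²≡q³+qc ⟩
    q * (q * q) + q * c + q * (q * q)    ≡⟨ solve (q ∷ c ∷ []) ⟩
    q * (q * q) * 2 + q * c              ∎))
    where open ≤-Reasoning

  2*q*n+q*q*w≤n*n+q*q : ∀ q n w → w ≡ 0 ⊎ (n ≡ 0 × w ≡ 1) → 2 * q * n + q * q * w ≤ n * n + q * q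
  2*q*n+q*q*w≤n*n+q*q q n .0 (inj₁ ≡.refl) = begin
    2 * q * n + q * q * 0  ≡⟨ solve (q ∷ n ∷ []) ⟩
    2 * q * n              ≤⟨ 2*m*n≤m*m+n*n q n ⟩
    q * q + n * n          ≡⟨ +-comm (q * q) (n * n) ⟩
    n * n + q * q          ∎
    where open ≤-Reasoning
  2*q*n+q*q*w≤n*n+q*q q .0 .1 (inj₂ (≡.refl , ≡.refl)) = ≤-reflexive (solve (q ∷ []))

module Counting {r ℓ} (k : CommutativeRing r ℓ) (finite : IsFinite k) where
  open CommutativeRing k using (Carrier; _≈_; sym; trans; reflexive)
  open IsFinite finite
  open import Data.Nat.Properties as ℕP using (+-*-semiring)
  open import Algebra.Properties.Semiring.Sum +-*-semiring
    using (sum; sum-cong-≗; sum-replicate-zero; ∑-comm; ∑-distrib-+; ∑-permute; *-distribˡ-sum; *-distribʳ-sum)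
  open import Data.Fin as Fin using (Fin)
  open import Data.Fin.Properties using (any?; suc-injective)
  import Data.Fin.Permutation as Perm
  open import Data.Vec.Functional using (Vector)
  open import Relation.Nullary.Decidable using (map′)
  open import Relation.Binary.Definitions using (Decidable)
  open import Data.List using (List; []; _∷_; length)
  open import Data.List.Relation.Unary.Any using (Any; here; there)
  open ≡.≡-Reasoning

  infix 4 _≟_
  _≟_ : Decidable _≈_
  x ≟ y = map′ (λ e → trans (sym (enum-index x)) (trans (reflexive (≡.cong enum e)) (enum-index y)))
               index-cong (index x Fin.≟ index y)

  ∃? : ∀ {p} {P : Carrier → Set p} → (∀ x → Dec (P x)) → (∀ {x y} → x ≈ y → P x → P y) →
       Dec (∃ P)
  ∃? P? resp = map′ (λ (i , p) → enum i , p) (λ (x , p) → index x , resp (sym (enum-index x)) p)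
                    (any? (λ i → P? (enum i)))

  ∑ : (Carrier → ℕ) → ℕ
  ∑ f = sum (λ i → f (enum i))

  syntax ∑ (λ x → e) = ∑[ x ] e

  sum-const : ∀ n m → sum {n} (λ _ → m) ≡ n ℕ.* m
  sum-const zero    m = ≡.refl
  sum-const (suc n) m = ≡.cong (m ℕ.+_) (sum-const n m)

  sum-mono-≤ : ∀ {n} {f g : Vector ℕ n} → (∀ i → f i ℕ.≤ g i) → sum f ℕ.≤ sum g
  sum-mono-≤ {zero}  f≤g = ℕ.z≤n
  sum-mono-≤ {suc n} f≤g = ℕP.+-mono-≤ (f≤g Fin.zero) (sum-mono-≤ (λ i → f≤g (Fin.suc i)))

  sum-single : ∀ {n} (j : Fin n) (g : Vector ℕ n) → (∀ i → i ≢ j → g i ≡ 0) → sum g ≡ g j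
  sum-single {suc n} Fin.zero g g≡0 = begin
    g Fin.zero ℕ.+ sum (λ i → g (Fin.suc i)) ≡⟨ ≡.cong (g Fin.zero ℕ.+_) (≡.trans (sum-cong-≗ (λ i → g≡0 (Fin.suc i) λ ())) (sum-replicate-zero n)) ⟩
    g Fin.zero ℕ.+ 0                          ≡⟨ ℕP.+-identityʳ (g Fin.zero) ⟩
    g Fin.zero                                ∎
  sum-single {suc n} (Fin.suc j) g g≡0 =
    ≡.cong₂ ℕ._+_ (g≡0 Fin.zero λ ()) (sum-single j (λ i → g (Fin.suc i)) (λ i i≢j → g≡0 (Fin.suc i) (λ e → i≢j (suc-injective e))))

  ∑-cong : ∀ {f g : Carrier → ℕ} → (∀ x → f x ≡ g x) → ∑ f ≡ ∑ g
  ∑-cong f≡g = sum-cong-≗ (λ i → f≡g (enum i))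

  ∑-const : ∀ m → ∑[ x ] m ≡ size ℕ.* m
  ∑-const = sum-const size

  ∑-mono-≤ : ∀ {f g : Carrier → ℕ} → (∀ x → f x ℕ.≤ g x) → ∑ f ℕ.≤ ∑ g
  ∑-mono-≤ f≤g = sum-mono-≤ (λ i → f≤g (enum i))

  ∑-+ : ∀ (f g : Carrier → ℕ) → ∑[ x ] (f x ℕ.+ g x) ≡ ∑ f ℕ.+ ∑ g
  ∑-+ f g = ∑-distrib-+ (λ i → f (enum i)) (λ i → g (enum i))

  ∑-*ˡ : ∀ m (f : Carrier → ℕ) → ∑[ x ] (m ℕ.* f x) ≡ m ℕ.* ∑ f
  ∑-*ˡ m f = ≡.sym (*-distribˡ-sum m (λ i → f (enum i)))

  ∑-*ʳ : ∀ m (f : Carrier → ℕ) → ∑[ x ] (f x ℕ.* m) ≡ ∑ f ℕ.* m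
  ∑-*ʳ m f = ≡.sym (*-distribʳ-sum m (λ i → f (enum i)))

  ∑-swap : ∀ (f : Carrier → Carrier → ℕ) → ∑[ x ] ∑[ y ] f x y ≡ ∑[ y ] ∑[ x ] f x y
  ∑-swap f = ∑-comm (λ i j → f (enum i) (enum j))

  ∑-reindex : ∀ (φ ψ : Carrier → Carrier) → φ Preserves _≈_ ⟶ _≈_ → ψ Preserves _≈_ ⟶ _≈_ →
              (∀ x → ψ (φ x) ≈ x) → (∀ y → φ (ψ y) ≈ y) →
              ∀ (f : Carrier → ℕ) → f Preserves _≈_ ⟶ _≡_ → ∑[ x ] f (φ x) ≡ ∑ f
  ∑-reindex φ ψ φ-cong ψ-cong ψφ φψ f f-resp = begin
    ∑[ x ] f (φ x)                          ≡⟨ ∑-cong (λ x → f-resp (sym (enum-index (φ x)))) ⟩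
    sum (λ i → f (enum (π Perm.⟨$⟩ʳ i)))    ≡⟨ ∑-permute (λ i → f (enum i)) π ⟨
    ∑ f                                     ∎
    where
    lift : (Carrier → Carrier) → Fin size → Fin size
    lift h i = index (h (enum i))
    lift-inverse : ∀ {h g} → h Preserves _≈_ ⟶ _≈_ → (∀ y → h (g y) ≈ y) → ∀ i → lift h (lift g i) ≡ i
    lift-inverse {h} {g} h-cong hg i =
      ≡.trans (index-cong (trans (h-cong (enum-index (g (enum i)))) (hg (enum i)))) (index-enum i)
    π : Perm.Permutation size size
    π = Perm.permutation (lift φ) (lift ψ) (lift-inverse φ-cong φψ) (lift-inverse ψ-cong ψφ)

  ∑∑-+ : ∀ (f g : Carrier → Carrier → ℕ) →
         ∑[ x ] ∑[ y ] (f x y ℕ.+ g x y) ≡ ∑[ x ] ∑[ y ] f x y ℕ.+ ∑[ x ] ∑[ y ] g x y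
  ∑∑-+ f g = ≡.trans (∑-cong (λ x → ∑-+ (f x) (g x))) (∑-+ (λ x → ∑ (f x)) (λ x → ∑ (g x)))

  ∑∑-const : ∀ m → ∑[ x ] ∑[ y ] m ≡ size ℕ.* (size ℕ.* m)
  ∑∑-const m = ≡.trans (∑-cong (λ _ → ∑-const m)) (∑-const (size ℕ.* m))

  -- Opaque, so that unification and with-abstraction never unfold the decision procedure.
  opaque
    𝟙[_≈_] : Carrier → Carrier → ℕ
    𝟙[ x ≈ y ] with x ≟ y
    ... | yes _ = 1
    ... | no  _ = 0

    𝟙-yes : ∀ {x y} → x ≈ y → 𝟙[ x ≈ y ] ≡ 1
    𝟙-yes {x} {y} x≈y with x ≟ y
    ... | yes _    = ≡.refl
    ... | no  x≉y = ⊥-elim (x≉y x≈y)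

    𝟙-no : ∀ {x y} → ¬ x ≈ y → 𝟙[ x ≈ y ] ≡ 0
    𝟙-no {x} {y} x≉y with x ≟ y
    ... | yes x≈y = ⊥-elim (x≉y x≈y)
    ... | no  _   = ≡.refl

    𝟙-cong : ∀ {x y u v} → (x ≈ y → u ≈ v) → (u ≈ v → x ≈ y) → 𝟙[ x ≈ y ] ≡ 𝟙[ u ≈ v ]
    𝟙-cong {x} {y} to from with x ≟ y
    ... | yes x≈y = ≡.sym (𝟙-yes (to x≈y))
    ... | no  x≉y = ≡.sym (𝟙-no (λ u≈v → x≉y (from u≈v)))

    𝟙-≤ : ∀ {x y n} → (x ≈ y → 1 ℕ.≤ n) → 𝟙[ x ≈ y ] ℕ.≤ n
    𝟙-≤ {x} {y} 1≤n with x ≟ y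
    ... | yes x≈y = 1≤n x≈y
    ... | no  _   = ℕ.z≤n

  𝟙-congˡ : ∀ {x u y} → x ≈ u → 𝟙[ x ≈ y ] ≡ 𝟙[ u ≈ y ]
  𝟙-congˡ x≈u = 𝟙-cong (trans (sym x≈u)) (trans x≈u)

  𝟙-congʳ : ∀ {x y v} → y ≈ v → 𝟙[ x ≈ y ] ≡ 𝟙[ x ≈ v ]
  𝟙-congʳ y≈v = 𝟙-cong (λ x≈y → trans x≈y y≈v) (λ x≈v → trans x≈v (sym y≈v))

  𝟙-sym : ∀ x y → 𝟙[ x ≈ y ] ≡ 𝟙[ y ≈ x ]
  𝟙-sym x y = 𝟙-cong sym sym

  ∑-𝟙-* : ∀ a (f : Carrier → ℕ) → f Preserves _≈_ ⟶ _≡_ → ∑[ x ] (𝟙[ x ≈ a ] ℕ.* f x) ≡ f a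
  ∑-𝟙-* a f f-resp = begin
    ∑[ x ] (𝟙[ x ≈ a ] ℕ.* f x)                   ≡⟨ sum-single (index a) _ elsewhere ⟩
    𝟙[ enum (index a) ≈ a ] ℕ.* f (enum (index a)) ≡⟨ ≡.cong₂ ℕ._*_ (𝟙-yes (enum-index a)) (f-resp (enum-index a)) ⟩
    1 ℕ.* f a                                      ≡⟨ ℕP.*-identityˡ (f a) ⟩
    f a                                            ∎
    where
    elsewhere : ∀ i → i ≢ index a → 𝟙[ enum i ≈ a ] ℕ.* f (enum i) ≡ 0
    elsewhere i i≢a = ≡.cong (ℕ._* f (enum i)) (𝟙-no (λ e → i≢a (≡.trans (≡.sym (index-enum i)) (index-cong e))))

  ∑-𝟙 : ∀ a → ∑[ x ] 𝟙[ x ≈ a ] ≡ 1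
  ∑-𝟙 a = ≡.trans (∑-cong (λ x → ≡.sym (ℕP.*-identityʳ 𝟙[ x ≈ a ]))) (∑-𝟙-* a (λ _ → 1) (λ _ → ≡.refl))

  ∑-fibres : ∀ (F : Carrier → Carrier → Carrier) (g : Carrier → ℕ) → g Preserves _≈_ ⟶ _≡_ →
             ∑[ z ] ((∑[ x ] ∑[ y ] 𝟙[ F x y ≈ z ]) ℕ.* g z) ≡ ∑[ x ] ∑[ y ] g (F x y)
  ∑-fibres F g g-resp = begin
    ∑[ z ] ((∑[ x ] ∑[ y ] 𝟙[ F x y ≈ z ]) ℕ.* g z)  ≡⟨ ∑-cong (λ z → ≡.trans (≡.sym (∑-*ʳ (g z) (λ x → ∑[ y ] 𝟙[ F x y ≈ z ])))
                                                                     (∑-cong (λ x → ≡.sym (∑-*ʳ (g z) (λ y → 𝟙[ F x y ≈ z ]))))) ⟩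
    ∑[ z ] ∑[ x ] ∑[ y ] (𝟙[ F x y ≈ z ] ℕ.* g z)    ≡⟨ ∑-swap (λ z x → ∑[ y ] (𝟙[ F x y ≈ z ] ℕ.* g z)) ⟩
    ∑[ x ] ∑[ z ] ∑[ y ] (𝟙[ F x y ≈ z ] ℕ.* g z)    ≡⟨ ∑-cong (λ x → ∑-swap (λ z y → 𝟙[ F x y ≈ z ] ℕ.* g z)) ⟩
    ∑[ x ] ∑[ y ] ∑[ z ] (𝟙[ F x y ≈ z ] ℕ.* g z)    ≡⟨ ∑-cong (λ x → ∑-cong (λ y → fibre (F x y))) ⟩
    ∑[ x ] ∑[ y ] g (F x y)                          ∎
    where
    fibre : ∀ a → ∑[ z ] (𝟙[ a ≈ z ] ℕ.* g z) ≡ g a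
    fibre a = ≡.trans (∑-cong (λ z → ≡.cong (ℕ._* g z) (𝟙-sym a z))) (∑-𝟙-* a g g-resp)

  hits : List Carrier → Carrier → ℕ
  hits []       t = 0
  hits (r ∷ rs) t = 𝟙[ t ≈ r ] ℕ.+ hits rs t

  ∑-hits : ∀ rs → ∑ (hits rs) ≡ length rs
  ∑-hits []       = ≡.trans (∑-const 0) (ℕP.*-zeroʳ size)
  ∑-hits (r ∷ rs) = ≡.trans (∑-+ (λ t → 𝟙[ t ≈ r ]) (hits rs)) (≡.cong₂ ℕ._+_ (∑-𝟙 r) (∑-hits rs))

  hits-any : ∀ {t rs} → Any (t ≈_) rs → 1 ℕ.≤ hits rs t
  hits-any (here t≈r)  = ℕP.≤-trans (ℕP.≤-reflexive (≡.sym (𝟙-yes t≈r))) (ℕP.m≤m+n _ _)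
  hits-any (there any) = ℕP.m≤n⇒m≤o+n _ (hits-any any)

  count-≤-candidates : ∀ (u v : Carrier → Carrier) (rs : List Carrier) →
                       (∀ t → u t ≈ v t → Any (t ≈_) rs) → ∑[ t ] 𝟙[ u t ≈ v t ] ℕ.≤ length rs
  count-≤-candidates u v rs candidates = ℕP.≤-trans
    (∑-mono-≤ (λ t → 𝟙-≤ (λ e → hits-any (candidates t e))))
    (ℕP.≤-reflexive (∑-hits rs))

module FieldArithmetic {r ℓ} (k : CommutativeRing r ℓ) (isField : IsField k) (finite : IsFinite k) where
  open CommutativeRing k
  open IsField isField
  open Counting k finite
  open IntegerCoefficientSolver k
  open import Algebra.Properties.Ring ring using (x∙y⁻¹≈ε⇒x≈y; x≈y⇒x∙y⁻¹≈ε; +-inverseˡ-unique)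
  open import Data.Product using (proj₁; proj₂)
  open import Relation.Binary.Reasoning.Setoid setoid

  _⁻¹⟨_⟩ : ∀ x → ¬ x ≈ 0# → Carrier
  x ⁻¹⟨ x≉0 ⟩ = proj₁ (inverse x x≉0)

  *-inverseʳ : ∀ x (x≉0 : ¬ x ≈ 0#) → x * x ⁻¹⟨ x≉0 ⟩ ≈ 1#
  *-inverseʳ x x≉0 = proj₂ (inverse x x≉0)

  ⁻¹-nonzero : ∀ {x} (x≉0 : ¬ x ≈ 0#) → ¬ x ⁻¹⟨ x≉0 ⟩ ≈ 0#
  ⁻¹-nonzero {x} x≉0 x⁻¹≈0 = 1≉0 (trans (sym (*-inverseʳ x x≉0)) (trans (*-congˡ x⁻¹≈0) (zeroʳ x)))

  x*y≈z⇒y≈x⁻¹*z : ∀ {x y z} (x≉0 : ¬ x ≈ 0#) → x * y ≈ z → y ≈ x ⁻¹⟨ x≉0 ⟩ * z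
  x*y≈z⇒y≈x⁻¹*z {x} {y} {z} x≉0 xy≈z = begin
    y                                ≈⟨ *-identityˡ y ⟨
    1# * y                           ≈⟨ *-congʳ (trans (*-comm _ x) (*-inverseʳ x x≉0)) ⟨
    (x ⁻¹⟨ x≉0 ⟩ * x) * y            ≈⟨ *-assoc _ x y ⟩
    x ⁻¹⟨ x≉0 ⟩ * (x * y)            ≈⟨ *-congˡ xy≈z ⟩
    x ⁻¹⟨ x≉0 ⟩ * z                  ∎

  zero-product : ∀ {x y} → x * y ≈ 0# → x ≈ 0# ⊎ y ≈ 0#
  zero-product {x} xy≈0 with x ≟ 0#
  ... | yes x≈0 = inj₁ x≈0
  ... | no  x≉0 = inj₂ (trans (x*y≈z⇒y≈x⁻¹*z x≉0 xy≈0) (zeroʳ _))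

  nonzero-product : ∀ {x y} → ¬ x ≈ 0# → ¬ y ≈ 0# → ¬ x * y ≈ 0#
  nonzero-product x≉0 y≉0 xy≈0 with zero-product xy≈0
  ... | inj₁ x≈0 = x≉0 x≈0
  ... | inj₂ y≈0 = y≉0 y≈0

  𝟙-cong-sub : ∀ {x y u v} → x - y ≈ u - v → 𝟙[ x ≈ y ] ≡ 𝟙[ u ≈ v ]
  𝟙-cong-sub {x} {y} {u} {v} e = 𝟙-cong
    (λ x≈y → x∙y⁻¹≈ε⇒x≈y u v (trans (sym e) (x≈y⇒x∙y⁻¹≈ε x≈y)))
    (λ u≈v → x∙y⁻¹≈ε⇒x≈y x y (trans e (x≈y⇒x∙y⁻¹≈ε u≈v)))

  monic-quadratic-roots : ∀ {p q r t} → r * r + p * r + q ≈ 0# → t * t + p * t + q ≈ 0# →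
                          t ≈ r ⊎ t ≈ - (p + r)
  monic-quadratic-roots {p} {q} {r} {t} r-root t-root =
    Sum.map (x∙y⁻¹≈ε⇒x≈y t r) (+-inverseˡ-unique t (p + r)) (zero-product (begin
      (t - r) * (t + (p + r))
        ≈⟨ solve 4 (λ p q r t → (t :- r) :* (t :+ (p :+ r)) := (t :* t :+ p :* t :+ q) :- (r :* r :+ p :* r :+ q)) refl p q r t ⟩
      (t * t + p * t + q) - (r * r + p * r + q)  ≈⟨ x≈y⇒x∙y⁻¹≈ε (trans t-root (sym r-root)) ⟩
      0#                                         ∎))

  cube-roots : ∀ {a t} → t * t * t ≈ a * a * a → t ≈ a ⊎ t * t + a * t + a * a ≈ 0#
  cube-roots {a} {t} t³≈a³ = Sum.map₁ (x∙y⁻¹≈ε⇒x≈y t a) (zero-product (begin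
    (t - a) * (t * t + a * t + a * a)  ≈⟨ solve 2 (λ a t → (t :- a) :* (t :* t :+ a :* t :+ a :* a) := t :* t :* t :- a :* a :* a) refl a t ⟩
    t * t * t - a * a * a              ≈⟨ x≈y⇒x∙y⁻¹≈ε t³≈a³ ⟩
    0#                                 ∎))

  pow-cong : ∀ n {x y} → x ≈ y → pow k x n ≈ pow k y n
  pow-cong zero    x≈y = refl
  pow-cong (suc n) x≈y = *-cong x≈y (pow-cong n x≈y)

  pow-nonzero : ∀ {x} → ¬ x ≈ 0# → ∀ n → ¬ pow k x n ≈ 0#
  pow-nonzero x≉0 zero    = 1≉0
  pow-nonzero x≉0 (suc n) = nonzero-product x≉0 (pow-nonzero x≉0 n)

  pow-1# : ∀ n → pow k 1# n ≈ 1#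
  pow-1# zero    = refl
  pow-1# (suc n) = trans (*-identityˡ _) (pow-1# n)

  cube-cong : ∀ {x y} → x ≈ y → x * x * x ≈ y * y * y
  cube-cong x≈y = *-cong (*-cong x≈y x≈y) x≈y

  quadratic-cong : ∀ {a x y} → x ≈ y → x * x + a * x + a * a ≈ y * y + a * y + a * a
  quadratic-cong x≈y = +-congʳ (+-cong (*-cong x≈y x≈y) (*-congˡ x≈y))

  cube-zero : ∀ {t} → t * t * t ≈ 0# → t ≈ 0#
  cube-zero t³≈0 with zero-product t³≈0
  ... | inj₂ t≈0 = t≈0
  ... | inj₁ t²≈0 with zero-product t²≈0
  ...   | inj₁ t≈0 = t≈0
  ...   | inj₂ t≈0 = t≈0

  sixth-roots-of-unity : ∀ {c} → pow k c 6 ≈ 1# →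
    c - ι k 1 ≈ 0# ⊎ c + ι k 1 ≈ 0# ⊎ c * c + c + ι k 1 ≈ 0# ⊎ c * c - c + ι k 1 ≈ 0#
  sixth-roots-of-unity {c} c⁶≈1 = Sum.map₂ (Sum.map₂ zero-product ∘ zero-product) (zero-product (begin
    (c - ι k 1) * ((c + ι k 1) * ((c * c + c + ι k 1) * (c * c - c + ι k 1)))
      ≈⟨ solve 1 (λ c → (c :- con (1 , 0)) :* ((c :+ con (1 , 0)) :* ((c :* c :+ c :+ con (1 , 0)) :* (c :* c :- c :+ con (1 , 0))))
                        := c :^ 6 :- con (1 , 0)) refl c ⟩
    pow k c 6 - ι k 1  ≈⟨ x≈y⇒x∙y⁻¹≈ε (trans c⁶≈1 (sym (+-identityʳ 1#))) ⟩
    0#                 ∎))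

module RootCounts {r ℓ} (k : CommutativeRing r ℓ) (isField : IsField k) (finite : IsFinite k) where
  open CommutativeRing k
  open IsFinite finite using (size)
  open Counting k finite
  open FieldArithmetic k isField finite
  open import Data.Nat.Properties as ℕP using ()
  open import Data.List using ([]; _∷_; length)
  open import Data.List.Relation.Unary.Any using (Any; here; there)
  import Relation.Binary.Reasoning.Setoid

  linear-count-nonzero : ∀ {d} s → ¬ d ≈ 0# → ∑[ n ] 𝟙[ d * n ≈ s ] ≡ 1
  linear-count-nonzero {d} s d≉0 = ≡.trans (∑-cong (λ n → 𝟙-cong (x*y≈z⇒y≈x⁻¹*z d≉0) (solved n))) (∑-𝟙 _)
    where
    open Relation.Binary.Reasoning.Setoid setoid
    solved : ∀ n → n ≈ d ⁻¹⟨ d≉0 ⟩ * s → d * n ≈ s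
    solved n n≈d⁻¹s = begin
      d * n                    ≈⟨ *-congˡ n≈d⁻¹s ⟩
      d * (d ⁻¹⟨ d≉0 ⟩ * s)    ≈⟨ *-assoc d _ s ⟨
      (d * d ⁻¹⟨ d≉0 ⟩) * s    ≈⟨ *-congʳ (*-inverseʳ d d≉0) ⟩
      1# * s                   ≈⟨ *-identityˡ s ⟩
      s                        ∎

  linear-count-zero : ∀ {d} s → d ≈ 0# → ∑[ n ] 𝟙[ d * n ≈ s ] ≡ size ℕ.* 𝟙[ 0# ≈ s ]
  linear-count-zero {d} s d≈0 = ≡.trans (∑-cong (λ n → 𝟙-congˡ (trans (*-congʳ d≈0) (zeroˡ n)))) (∑-const _)

  linear-count : ∀ d s → ∑[ n ] 𝟙[ d * n ≈ s ] ℕ.+ 𝟙[ d ≈ 0# ] ≡ 1 ℕ.+ size ℕ.* 𝟙[ 0# ≈ s ] ℕ.* 𝟙[ d ≈ 0# ]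
  linear-count d s = by-cases (d ≟ 0#)
    where
    open ≡.≡-Reasoning
    by-cases : Dec (d ≈ 0#) → ∑[ n ] 𝟙[ d * n ≈ s ] ℕ.+ 𝟙[ d ≈ 0# ] ≡ 1 ℕ.+ size ℕ.* 𝟙[ 0# ≈ s ] ℕ.* 𝟙[ d ≈ 0# ]
    by-cases (yes d≈0) = begin
      ∑[ n ] 𝟙[ d * n ≈ s ] ℕ.+ 𝟙[ d ≈ 0# ]          ≡⟨ ≡.cong₂ ℕ._+_ (linear-count-zero s d≈0) (𝟙-yes d≈0) ⟩
      size ℕ.* 𝟙[ 0# ≈ s ] ℕ.+ 1                     ≡⟨ ℕP.+-comm _ 1 ⟩
      1 ℕ.+ size ℕ.* 𝟙[ 0# ≈ s ]
        ≡⟨ ≡.cong (1 ℕ.+_) (≡.trans (≡.cong (size ℕ.* 𝟙[ 0# ≈ s ] ℕ.*_) (𝟙-yes d≈0)) (ℕP.*-identityʳ _)) ⟨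
      1 ℕ.+ size ℕ.* 𝟙[ 0# ≈ s ] ℕ.* 𝟙[ d ≈ 0# ]      ∎
    by-cases (no d≉0) = begin
      ∑[ n ] 𝟙[ d * n ≈ s ] ℕ.+ 𝟙[ d ≈ 0# ]          ≡⟨ ≡.cong₂ ℕ._+_ (linear-count-nonzero s d≉0) (𝟙-no d≉0) ⟩
      1 ℕ.+ 0
        ≡⟨ ≡.cong (1 ℕ.+_) (≡.trans (≡.cong (size ℕ.* 𝟙[ 0# ≈ s ] ℕ.*_) (𝟙-no d≉0)) (ℕP.*-zeroʳ (size ℕ.* 𝟙[ 0# ≈ s ]))) ⟨
      1 ℕ.+ size ℕ.* 𝟙[ 0# ≈ s ] ℕ.* 𝟙[ d ≈ 0# ]      ∎

  cube-root-count : Carrier → ℕ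
  cube-root-count b = ∑[ t ] 𝟙[ t * t * t ≈ b ]

  cube-root-count-≤3 : ∀ b → cube-root-count b ℕ.≤ 3
  cube-root-count-≤3 b = by-root (∃? (λ a → a * a * a ≟ b) (λ x≈y → trans (cube-cong (sym x≈y))))
    where
    count-≤ : ∀ rs → (∀ t → t * t * t ≈ b → Any (t ≈_) rs) → cube-root-count b ℕ.≤ length rs
    count-≤ = count-≤-candidates (λ t → t * t * t) (λ _ → b)
    by-root : Dec (∃ λ a → a * a * a ≈ b) → cube-root-count b ℕ.≤ 3
    by-root (no ∄a) = ℕP.≤-trans (count-≤ [] (λ t t³≈b → ⊥-elim (∄a (t , t³≈b)))) ℕ.z≤n
    by-root (yes (a , a³≈b)) = by-quadratic-root (∃? (λ r → r * r + a * r + a * a ≟ 0#) (λ x≈y → trans (quadratic-cong (sym x≈y))))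
      where
      by-quadratic-root : Dec (∃ λ r → r * r + a * r + a * a ≈ 0#) → cube-root-count b ℕ.≤ 3
      by-quadratic-root (no ∄r) = ℕP.≤-trans (count-≤ (a ∷ []) only-a) (ℕ.s≤s ℕ.z≤n)
        where
        only-a : ∀ t → t * t * t ≈ b → Any (t ≈_) (a ∷ [])
        only-a t t³≈b = [ here , (λ t-root → ⊥-elim (∄r (t , t-root))) ]′ (cube-roots (trans t³≈b (sym a³≈b)))
      by-quadratic-root (yes (r , r-root)) = count-≤ (a ∷ r ∷ - (a + r) ∷ []) three
        where
        three : ∀ t → t * t * t ≈ b → Any (t ≈_) (a ∷ r ∷ - (a + r) ∷ [])
        three t t³≈b = [ here , (λ t-root → there ([ here , (λ t≈-a-r → there (here t≈-a-r)) ]′ (monic-quadratic-roots r-root t-root))) ]′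
                        (cube-roots (trans t³≈b (sym a³≈b)))

  cube-root-count-0≤1 : cube-root-count 0# ℕ.≤ 1
  cube-root-count-0≤1 = count-≤-candidates (λ t → t * t * t) (λ _ → 0#) (0# ∷ []) (λ t t³≈0 → here (cube-zero t³≈0))

  cube-collisions : ℕ
  cube-collisions = ∑[ x ] cube-root-count (x * x * x)

  cube-collisions-bound : cube-collisions ℕ.+ 2 ℕ.≤ size ℕ.* 3
  cube-collisions-bound = begin
    cube-collisions ℕ.+ 2                                        ≡⟨ ≡.cong (λ n → cube-collisions ℕ.+ 2 ℕ.* n) (∑-𝟙 0#) ⟨
    cube-collisions ℕ.+ 2 ℕ.* ∑[ x ] 𝟙[ x ≈ 0# ]                ≡⟨ ≡.cong (cube-collisions ℕ.+_) (∑-*ˡ 2 (λ x → 𝟙[ x ≈ 0# ])) ⟨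
    cube-collisions ℕ.+ ∑[ x ] (2 ℕ.* 𝟙[ x ≈ 0# ])             ≡⟨ ∑-+ (λ x → cube-root-count (x * x * x)) (λ x → 2 ℕ.* 𝟙[ x ≈ 0# ]) ⟨
    ∑[ x ] (cube-root-count (x * x * x) ℕ.+ 2 ℕ.* 𝟙[ x ≈ 0# ])  ≤⟨ ∑-mono-≤ pointwise ⟩
    ∑[ x ] 3                                                     ≡⟨ ∑-const 3 ⟩
    size ℕ.* 3                                                   ∎
    where
    open ℕP.≤-Reasoning
    pointwise : ∀ x → cube-root-count (x * x * x) ℕ.+ 2 ℕ.* 𝟙[ x ≈ 0# ] ℕ.≤ 3
    pointwise x with x ≟ 0#
    ... | yes x≈0 = ℕP.+-mono-≤ (ℕP.≤-trans (ℕP.≤-reflexive (∑-cong (λ t → 𝟙-congʳ {t * t * t} x³≈0))) cube-root-count-0≤1)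
                                (ℕP.≤-reflexive (≡.cong (2 ℕ.*_) (𝟙-yes x≈0)))
      where
      x³≈0 : x * x * x ≈ 0#
      x³≈0 = trans (cube-cong x≈0) (zeroʳ (0# * 0#))
    ... | no x≉0 = ℕP.≤-trans (ℕP.≤-reflexive (≡.trans (≡.cong (λ n → cube-root-count (x * x * x) ℕ.+ 2 ℕ.* n) (𝟙-no x≉0)) (ℕP.+-identityʳ _)))
                              (cube-root-count-≤3 (x * x * x))

module CurvePoints {r ℓ} (k : CommutativeRing r ℓ) (isField : IsField k) (finite : IsFinite k)
                   (2≉0 : ¬ CommutativeRing._≈_ k (ι k 2) (CommutativeRing.0# k)) where
  open CommutativeRing k
  open Counting k finite
  open FieldArithmetic k isField finite
  open RootCounts k isField finite
  open IntegerCoefficientSolver k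
  open import Data.Nat.Properties as ℕP using ()
  open import Relation.Nullary.Decidable using (¬?; _×-dec_; decidable-stable)
  import Data.Product as Product
  open import Data.Fin.Properties using (nonZeroIndex)
  open IsFinite finite using (size; index)
  open NatArithmetic
  open import Algebra.Properties.Ring ring using (x≈y⇒x∙y⁻¹≈ε; x∙y⁻¹≈ε⇒x≈y)
  import Relation.Binary.Reasoning.Setoid

  half : Carrier
  half = ι k 2 ⁻¹⟨ 2≉0 ⟩

  ∑-shift : ∀ y s → ∑[ y′ ] 𝟙[ y * y - y′ * y′ ≈ s ] ≡ ∑[ d ] 𝟙[ d * (y + y - d) ≈ s ]
  ∑-shift y s = begin
    ∑[ y′ ] 𝟙[ y * y - y′ * y′ ≈ s ]
      ≡⟨ ∑-cong (λ y′ → 𝟙-congˡ (solve 2 (λ y y′ → y :* y :- y′ :* y′ := (y :- y′) :* (y :+ y :- (y :- y′))) refl y y′)) ⟩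
    ∑[ y′ ] 𝟙[ (y - y′) * (y + y - (y - y′)) ≈ s ]
      ≡⟨ ∑-reindex (λ x → y - x) (λ x → y - x) y-cong y-cong y-[y-d] y-[y-d]
                   (λ d → 𝟙[ d * (y + y - d) ≈ s ]) (λ e → 𝟙-congˡ (*-cong e (+-congˡ (-‿cong e)))) ⟩
    ∑[ d ] 𝟙[ d * (y + y - d) ≈ s ]  ∎
    where
    open ≡.≡-Reasoning
    y-cong : ∀ {x x′} → x ≈ x′ → y - x ≈ y - x′
    y-cong e = +-congˡ (-‿cong e)
    y-[y-d] : ∀ d → y - (y - d) ≈ d
    y-[y-d] = solve 2 (λ y d → y :- (y :- d) := d) refl y

  ∑-rescale : ∀ d s → ∑[ y ] 𝟙[ d * (y + y - d) ≈ s ] ≡ ∑[ n ] 𝟙[ d * n ≈ s ]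
  ∑-rescale d s = ∑-reindex (λ y → y + y - d) (λ n → (n + d) * half)
    (λ e → +-congʳ (+-cong e e)) (λ e → *-congʳ (+-congʳ e)) halve double
    (λ n → 𝟙[ d * n ≈ s ]) (λ e → 𝟙-congˡ (*-congˡ e))
    where
    2*half : ι k 2 * half ≈ 1#
    2*half = *-inverseʳ (ι k 2) 2≉0
    halve : ∀ y → (y + y - d + d) * half ≈ y
    halve y = trans (solve 3 (λ y d h → (y :+ y :- d :+ d) :* h := y :* (con (2 , 0) :* h)) refl y d half)
                    (trans (*-congˡ 2*half) (*-identityʳ y))
    double : ∀ n → (n + d) * half + (n + d) * half - d ≈ n
    double n = trans (solve 3 (λ n d h → (n :+ d) :* h :+ (n :+ d) :* h :- d := (n :+ d) :* (con (2 , 0) :* h) :- d) refl n d half)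
                     (trans (+-congʳ (trans (*-congˡ 2*half) (*-identityʳ (n + d))))
                            (solve 2 (λ n d → n :+ d :- d := n) refl n d))

  difference-of-squares-count : ∀ s →
    ∑[ y ] ∑[ y′ ] 𝟙[ y * y - y′ * y′ ≈ s ] ℕ.+ 1 ≡ size ℕ.+ size ℕ.* 𝟙[ 0# ≈ s ]
  difference-of-squares-count s = begin
    ∑[ y ] ∑[ y′ ] 𝟙[ y * y - y′ * y′ ≈ s ] ℕ.+ 1
      ≡⟨ ≡.cong₂ ℕ._+_ (∑-cong (λ y → ∑-shift y s)) (≡.sym (∑-𝟙 0#)) ⟩
    ∑[ y ] ∑[ d ] 𝟙[ d * (y + y - d) ≈ s ] ℕ.+ ∑[ d ] 𝟙[ d ≈ 0# ]
      ≡⟨ ≡.cong (ℕ._+ ∑[ d ] 𝟙[ d ≈ 0# ]) (∑-swap (λ y d → 𝟙[ d * (y + y - d) ≈ s ])) ⟩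
    ∑[ d ] ∑[ y ] 𝟙[ d * (y + y - d) ≈ s ] ℕ.+ ∑[ d ] 𝟙[ d ≈ 0# ]
      ≡⟨ ∑-+ (λ d → ∑[ y ] 𝟙[ d * (y + y - d) ≈ s ]) (λ d → 𝟙[ d ≈ 0# ]) ⟨
    ∑[ d ] (∑[ y ] 𝟙[ d * (y + y - d) ≈ s ] ℕ.+ 𝟙[ d ≈ 0# ])
      ≡⟨ ∑-cong (λ d → ≡.trans (≡.cong (ℕ._+ 𝟙[ d ≈ 0# ]) (∑-rescale d s)) (linear-count d s)) ⟩
    ∑[ d ] (1 ℕ.+ size ℕ.* 𝟙[ 0# ≈ s ] ℕ.* 𝟙[ d ≈ 0# ])
      ≡⟨ ∑-+ (λ _ → 1) (λ d → size ℕ.* 𝟙[ 0# ≈ s ] ℕ.* 𝟙[ d ≈ 0# ]) ⟩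
    ∑[ d ] 1 ℕ.+ ∑[ d ] (size ℕ.* 𝟙[ 0# ≈ s ] ℕ.* 𝟙[ d ≈ 0# ])
      ≡⟨ ≡.cong₂ ℕ._+_ (∑-const 1) (∑-*ˡ (size ℕ.* 𝟙[ 0# ≈ s ]) (λ d → 𝟙[ d ≈ 0# ])) ⟩
    size ℕ.* 1 ℕ.+ size ℕ.* 𝟙[ 0# ≈ s ] ℕ.* ∑[ d ] 𝟙[ d ≈ 0# ]
      ≡⟨ ≡.cong₂ ℕ._+_ (ℕP.*-identityʳ size) (≡.trans (≡.cong (size ℕ.* 𝟙[ 0# ≈ s ] ℕ.*_) (∑-𝟙 0#)) (ℕP.*-identityʳ _)) ⟩
    size ℕ.+ size ℕ.* 𝟙[ 0# ≈ s ]  ∎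
    where open ≡.≡-Reasoning

  points : Carrier → ℕ
  points c = ∑[ x ] ∑[ y ] 𝟙[ y * y ≈ x * x * x + c ]

  points-cong : points Preserves _≈_ ⟶ _≡_
  points-cong c≈c′ = ∑-cong (λ x → ∑-cong (λ y → 𝟙-congʳ {y * y} (+-congˡ {x * x * x} c≈c′)))

  points-as-fibre : ∀ c → points c ≡ ∑[ x ] ∑[ y ] 𝟙[ y * y - x * x * x ≈ c ]
  points-as-fibre c = ∑-cong (λ x → ∑-cong (λ y → 𝟙-cong-sub
    (solve 3 (λ x y c → y :* y :- (x :* x :* x :+ c) := (y :* y :- x :* x :* x) :- c) refl x y c)))

  ∑-points : ∑ points ≡ size ℕ.* size
  ∑-points = begin
    ∑ points                                                    ≡⟨ ∑-cong (λ c → ≡.trans (points-as-fibre c) (≡.sym (ℕP.*-identityʳ _))) ⟩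
    ∑[ c ] ((∑[ x ] ∑[ y ] 𝟙[ y * y - x * x * x ≈ c ]) ℕ.* 1)   ≡⟨ ∑-fibres (λ x y → y * y - x * x * x) (λ _ → 1) (λ _ → ≡.refl) ⟩
    ∑[ x ] ∑[ y ] 1                                             ≡⟨ ∑∑-const 1 ⟩
    size ℕ.* (size ℕ.* 1)                                       ≡⟨ ≡.cong (size ℕ.*_) (ℕP.*-identityʳ size) ⟩
    size ℕ.* size                                               ∎
    where open ≡.≡-Reasoning

  ∑-points² : ∑[ c ] (points c ℕ.* points c) ℕ.+ size ℕ.* size ≡ size ℕ.* (size ℕ.* size) ℕ.+ size ℕ.* cube-collisions
  ∑-points² = begin
    ∑[ c ] (points c ℕ.* points c) ℕ.+ size ℕ.* size
      ≡⟨ ≡.cong₂ ℕ._+_ as-square-differences (≡.sym (≡.trans (∑∑-const 1) (≡.cong (size ℕ.*_) (ℕP.*-identityʳ size)))) ⟩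
    ∑[ x ] ∑[ x′ ] D x x′ ℕ.+ ∑[ x ] ∑[ x′ ] 1
      ≡⟨ ∑∑-+ D (λ _ _ → 1) ⟨
    ∑[ x ] ∑[ x′ ] (D x x′ ℕ.+ 1)
      ≡⟨ ∑-cong (λ x → ∑-cong (λ x′ → ≡.trans (difference-of-squares-count _) (≡.cong (λ n → size ℕ.+ size ℕ.* n) (cubes x x′)))) ⟩
    ∑[ x ] ∑[ x′ ] (size ℕ.+ size ℕ.* 𝟙[ x′ * x′ * x′ ≈ x * x * x ])
      ≡⟨ ∑∑-+ (λ _ _ → size) (λ x x′ → size ℕ.* 𝟙[ x′ * x′ * x′ ≈ x * x * x ]) ⟩
    ∑[ x ] ∑[ x′ ] size ℕ.+ ∑[ x ] ∑[ x′ ] (size ℕ.* 𝟙[ x′ * x′ * x′ ≈ x * x * x ])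
      ≡⟨ ≡.cong₂ ℕ._+_ (∑∑-const size) (≡.trans (∑-cong (λ x → ∑-*ˡ size (λ x′ → 𝟙[ x′ * x′ * x′ ≈ x * x * x ])))
                                                 (∑-*ˡ size (λ x → cube-root-count (x * x * x)))) ⟩
    size ℕ.* (size ℕ.* size) ℕ.+ size ℕ.* cube-collisions  ∎
    where
    open ≡.≡-Reasoning
    D : Carrier → Carrier → ℕ
    D x x′ = ∑[ y ] ∑[ y′ ] 𝟙[ y * y - y′ * y′ ≈ x * x * x - x′ * x′ * x′ ]
    cubes : ∀ x x′ → 𝟙[ 0# ≈ x * x * x - x′ * x′ * x′ ] ≡ 𝟙[ x′ * x′ * x′ ≈ x * x * x ]
    cubes x x′ = 𝟙-cong-sub (solve 2 (λ x x′ → con (0 , 0) :- (x :* x :* x :- x′ :* x′ :* x′) := x′ :* x′ :* x′ :- x :* x :* x) refl x x′)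
    as-square-differences : ∑[ c ] (points c ℕ.* points c) ≡ ∑[ x ] ∑[ x′ ] D x x′
    as-square-differences = begin
      ∑[ c ] (points c ℕ.* points c)
        ≡⟨ ∑-cong (λ c → ≡.cong (ℕ._* points c) (points-as-fibre c)) ⟩
      ∑[ c ] ((∑[ x ] ∑[ y ] 𝟙[ y * y - x * x * x ≈ c ]) ℕ.* points c)
        ≡⟨ ∑-fibres (λ x y → y * y - x * x * x) points points-cong ⟩
      ∑[ x ] ∑[ y ] points (y * y - x * x * x)
        ≡⟨ ∑-cong (λ x → ∑-cong (λ y → ∑-cong (λ x′ → ∑-cong (λ y′ → ≡.trans (𝟙-sym _ _) (𝟙-cong-sub
             (solve 4 (λ x y x′ y′ → x′ :* x′ :* x′ :+ (y :* y :- x :* x :* x) :- y′ :* y′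
                                    := (y :* y :- y′ :* y′) :- (x :* x :* x :- x′ :* x′ :* x′)) refl x y x′ y′)))))) ⟩
      ∑[ x ] ∑[ y ] ∑[ x′ ] ∑[ y′ ] 𝟙[ y * y - y′ * y′ ≈ x * x * x - x′ * x′ * x′ ]
        ≡⟨ ∑-cong (λ x → ∑-swap (λ y x′ → ∑[ y′ ] 𝟙[ y * y - y′ * y′ ≈ x * x * x - x′ * x′ * x′ ])) ⟩
      ∑[ x ] ∑[ x′ ] D x x′  ∎

  HasPoint : Carrier → Set _
  HasPoint c = ∃ λ x → ∃ λ y → y * y ≈ x * x * x + c

  points≡0 : ∀ {c} → ¬ HasPoint c → points c ≡ 0
  points≡0 {c} ∄point = begin
    points c                  ≡⟨ ∑-cong (λ x → ∑-cong (λ y → 𝟙-no (λ on-curve → ∄point (x , y , on-curve)))) ⟩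
    ∑[ x ] ∑[ y ] 0           ≡⟨ ∑∑-const 0 ⟩
    size ℕ.* (size ℕ.* 0)     ≡⟨ ≡.trans (≡.cong (size ℕ.*_) (ℕP.*-zeroʳ size)) (ℕP.*-zeroʳ size) ⟩
    0                         ∎
    where open ≡.≡-Reasoning

  no-two-pointless-curves : ∀ {c₀ c₁} → ¬ c₀ ≈ c₁ → points c₀ ≡ 0 → points c₁ ≡ 0 → ⊥
  no-two-pointless-curves {c₀} {c₁} c₀≉c₁ none₀ none₁ = ℕP.m+1+n≰m cube-collisions (ℕP.≤-trans cube-collisions-bound
    (second-moment-bound size (∑[ c ] (points c ℕ.* points c)) cube-collisions {{nonZeroIndex (index 0#)}} ∑-points² lower))
    where
    open ℕP.≤-Reasoning
    weight : Carrier → ℕ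
    weight c = 𝟙[ c ≈ c₀ ] ℕ.+ 𝟙[ c ≈ c₁ ]
    pointwise : ∀ c → 2 ℕ.* size ℕ.* points c ℕ.+ size ℕ.* size ℕ.* weight c ℕ.≤ points c ℕ.* points c ℕ.+ size ℕ.* size
    pointwise c = 2*q*n+q*q*w≤n*n+q*q size (points c) (weight c) (cases (c ≟ c₀) (c ≟ c₁))
      where
      cases : Dec (c ≈ c₀) → Dec (c ≈ c₁) → weight c ≡ 0 ⊎ (points c ≡ 0 × weight c ≡ 1)
      cases (yes c≈c₀) _ = inj₂ (≡.trans (points-cong c≈c₀) none₀ ,
                                 ≡.cong₂ ℕ._+_ (𝟙-yes c≈c₀) (𝟙-no (λ c≈c₁ → c₀≉c₁ (trans (sym c≈c₀) c≈c₁))))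
      cases (no c≉c₀) (yes c≈c₁) = inj₂ (≡.trans (points-cong c≈c₁) none₁ , ≡.cong₂ ℕ._+_ (𝟙-no c≉c₀) (𝟙-yes c≈c₁))
      cases (no c≉c₀) (no c≉c₁)  = inj₁ (≡.cong₂ ℕ._+_ (𝟙-no c≉c₀) (𝟙-no c≉c₁))
    lower : 2 ℕ.* size ℕ.* (size ℕ.* size) ℕ.+ size ℕ.* size ℕ.* 2 ℕ.≤ ∑[ c ] (points c ℕ.* points c) ℕ.+ size ℕ.* (size ℕ.* size)
    lower = begin
      2 ℕ.* size ℕ.* (size ℕ.* size) ℕ.+ size ℕ.* size ℕ.* 2
        ≡⟨ ≡.cong₂ ℕ._+_ (≡.cong (2 ℕ.* size ℕ.*_) ∑-points) (≡.cong (size ℕ.* size ℕ.*_) (≡.cong₂ ℕ._+_ (∑-𝟙 c₀) (∑-𝟙 c₁))) ⟨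
      2 ℕ.* size ℕ.* ∑ points ℕ.+ size ℕ.* size ℕ.* (∑[ c ] 𝟙[ c ≈ c₀ ] ℕ.+ ∑[ c ] 𝟙[ c ≈ c₁ ])
        ≡⟨ ≡.cong₂ ℕ._+_ (∑-*ˡ (2 ℕ.* size) points)
                         (≡.trans (∑-*ˡ (size ℕ.* size) weight) (≡.cong (size ℕ.* size ℕ.*_) (∑-+ (λ c → 𝟙[ c ≈ c₀ ]) (λ c → 𝟙[ c ≈ c₁ ])))) ⟨
      ∑[ c ] (2 ℕ.* size ℕ.* points c) ℕ.+ ∑[ c ] (size ℕ.* size ℕ.* weight c)
        ≡⟨ ∑-+ (λ c → 2 ℕ.* size ℕ.* points c) (λ c → size ℕ.* size ℕ.* weight c) ⟨
      ∑[ c ] (2 ℕ.* size ℕ.* points c ℕ.+ size ℕ.* size ℕ.* weight c)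
        ≤⟨ ∑-mono-≤ pointwise ⟩
      ∑[ c ] (points c ℕ.* points c ℕ.+ size ℕ.* size)
        ≡⟨ ≡.trans (∑-+ (λ c → points c ℕ.* points c) (λ _ → size ℕ.* size))
                   (≡.cong (∑[ c ] (points c ℕ.* points c) ℕ.+_) (∑-const (size ℕ.* size))) ⟩
      ∑[ c ] (points c ℕ.* points c) ℕ.+ size ℕ.* (size ℕ.* size)  ∎

  HasPoint? : ∀ c → Dec (HasPoint c)
  HasPoint? c = ∃? (λ x → ∃? (λ y → y * y ≟ x * x * x + c) (λ y≈y′ → trans (*-cong (sym y≈y′) (sym y≈y′))))
                   (λ x≈x′ (y , on-curve) → y , trans on-curve (+-congʳ (cube-cong x≈x′)))

  HasPoint-cong : ∀ {c c′} → c ≈ c′ → HasPoint c → HasPoint c′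
  HasPoint-cong c≈c′ (x , y , on-curve) = x , y , trans on-curve (+-congˡ c≈c′)

  HasPoint-scale : ∀ l {c} → HasPoint c → HasPoint (pow k l 6 * c)
  HasPoint-scale l {c} (x , y , on-curve) = l * l * x , l * l * l * y , (begin
    (l * l * l * y) * (l * l * l * y)                  ≈⟨ solve 2 (λ l y → (l :* l :* l :* y) :* (l :* l :* l :* y) := l :^ 6 :* (y :* y)) refl l y ⟩
    pow k l 6 * (y * y)                                ≈⟨ *-congˡ on-curve ⟩
    pow k l 6 * (x * x * x + c)
      ≈⟨ solve 3 (λ l x c → l :^ 6 :* (x :* x :* x :+ c) := (l :* l :* x) :* (l :* l :* x) :* (l :* l :* x) :+ l :^ 6 :* c) refl l x c ⟩
    (l * l * x) * (l * l * x) * (l * l * x) + pow k l 6 * c  ∎)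
    where open Relation.Binary.Reasoning.Setoid setoid

  HasPoint-by-factor : ∀ {c} x y K {F} → F ≈ 0# → y * y - (x * x * x + c) ≈ K * F → HasPoint c
  HasPoint-by-factor x y K F≈0 e = x , y , x∙y⁻¹≈ε⇒x≈y _ _ (trans e (trans (*-congˡ F≈0) (zeroʳ K)))

  sixth-root-of-unity-has-point : ∀ {c} → pow k c 6 ≈ 1# → HasPoint c
  sixth-root-of-unity-has-point {c} c⁶≈1 =
    [ c≈1 , [ c≈-1 , [ primitive-cube-root , primitive-sixth-root ]′ ]′ ]′ (sixth-roots-of-unity c⁶≈1)
    where
    c≈1 : c - ι k 1 ≈ 0# → HasPoint c
    c≈1 c-1≈0 = HasPoint-by-factor 0# (ι k 1) (- ι k 1) c-1≈0
      (solve 1 (λ c → con (1 , 0) :* con (1 , 0) :- (con (0 , 0) :* con (0 , 0) :* con (0 , 0) :+ c)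
                      := (:- con (1 , 0)) :* (c :- con (1 , 0))) refl c)
    c≈-1 : c + ι k 1 ≈ 0# → HasPoint c
    c≈-1 c+1≈0 = HasPoint-by-factor (ι k 1) 0# (- ι k 1) c+1≈0
      (solve 1 (λ c → con (0 , 0) :* con (0 , 0) :- (con (1 , 0) :* con (1 , 0) :* con (1 , 0) :+ c)
                      := (:- con (1 , 0)) :* (c :+ con (1 , 0))) refl c)
    primitive-cube-root : c * c + c + ι k 1 ≈ 0# → HasPoint c
    primitive-cube-root c²+c+1≈0 = HasPoint-by-factor 0# (c * c) (c * (c - ι k 1)) c²+c+1≈0
      (solve 1 (λ c → (c :* c) :* (c :* c) :- (con (0 , 0) :* con (0 , 0) :* con (0 , 0) :+ c)
                      := c :* (c :- con (1 , 0)) :* (c :* c :+ c :+ con (1 , 0))) refl c)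
    primitive-sixth-root : c * c - c + ι k 1 ≈ 0# → HasPoint c
    primitive-sixth-root c²-c+1≈0 = HasPoint-by-factor (- ι k 1) (- c) (ι k 1) c²-c+1≈0
      (solve 1 (λ c → (:- c) :* (:- c) :- ((:- con (1 , 0)) :* (:- con (1 , 0)) :* (:- con (1 , 0)) :+ c)
                      := con (1 , 0) :* (c :* c :- c :+ con (1 , 0))) refl c)

  has-point : ∀ {c} → ¬ c ≈ 0# → HasPoint c
  has-point {c} c≉0 = by-sixth-powers (∃? (λ l → ¬? (l ≟ 0#) ×-dec ¬? (pow k l 6 ≟ 1#))
                                         (λ l≈l′ → Product.map (_∘ trans l≈l′) (_∘ trans (pow-cong 6 l≈l′))))
    where
    open Relation.Binary.Reasoning.Setoid setoid
    by-sixth-powers : Dec (∃ λ l → ¬ l ≈ 0# × ¬ pow k l 6 ≈ 1#) → HasPoint c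
    by-sixth-powers (no ∄l) = sixth-root-of-unity-has-point
      (decidable-stable (pow k c 6 ≟ 1#) (λ c⁶≉1 → ∄l (c , c≉0 , c⁶≉1)))
    by-sixth-powers (yes (l , l≉0 , l⁶≉1)) = decidable-stable (HasPoint? c) (λ ∄point →
      l⁶≉1 (fixed (decidable-stable (c ≟ pow k l 6 * c)
        (λ c≉l⁶c → no-two-pointless-curves c≉l⁶c (points≡0 ∄point) (points≡0 (∄point ∘ unscaled))))))
      where
      l⁻¹ : Carrier
      l⁻¹ = l ⁻¹⟨ l≉0 ⟩
      unscaled : HasPoint (pow k l 6 * c) → HasPoint c
      unscaled point = HasPoint-cong (begin
        pow k l⁻¹ 6 * (pow k l 6 * c)  ≈⟨ solve 3 (λ m l c → m :^ 6 :* (l :^ 6 :* c) := (m :* l) :^ 6 :* c) refl l⁻¹ l c ⟩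
        pow k (l⁻¹ * l) 6 * c          ≈⟨ *-congʳ (pow-cong 6 (trans (*-comm l⁻¹ l) (*-inverseʳ l l≉0))) ⟩
        pow k 1# 6 * c                 ≈⟨ *-congʳ (pow-1# 6) ⟩
        1# * c                         ≈⟨ *-identityˡ c ⟩
        c                              ∎) (HasPoint-scale l⁻¹ point)
      fixed : c ≈ pow k l 6 * c → pow k l 6 ≈ 1#
      fixed c≈l⁶c = [ (λ l⁶-1≈0 → trans (x∙y⁻¹≈ε⇒x≈y _ _ l⁶-1≈0) (+-identityʳ 1#)) , (λ c≈0 → ⊥-elim (c≉0 c≈0)) ]′
        (zero-product (begin
          (pow k l 6 - ι k 1) * c   ≈⟨ solve 2 (λ l c → (l :^ 6 :- con (1 , 0)) :* c := l :^ 6 :* c :- c) refl l c ⟩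
          pow k l 6 * c - c         ≈⟨ x≈y⇒x∙y⁻¹≈ε (sym c≈l⁶c) ⟩
          0#                        ∎))

module Discriminants {r ℓ} (k : CommutativeRing r ℓ) where
  open CommutativeRing k
  open IntegerCoefficientSolver k

  -- The discriminant of Defs transcribed verbatim, so that it evaluates to Weierstrass.disc.
  discₚ : ∀ {n} → (a₁ a₂ a₃ a₄ a₆ : Polynomial n) → Polynomial n
  discₚ a₁ a₂ a₃ a₄ a₆ =
    :- (b₂ :* b₂ :* b₈) :- con (8 , 0) :* (b₄ :^ 3) :- con (27 , 0) :* (b₆ :* b₆) :+ con (9 , 0) :* b₂ :* b₄ :* b₆
    where
    b₂ = a₁ :* a₁ :+ con (4 , 0) :* a₂
    b₄ = a₁ :* a₃ :+ con (2 , 0) :* a₄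
    b₆ = a₃ :* a₃ :+ con (4 , 0) :* a₆
    b₈ = b₂ :* a₆ :- a₁ :* a₃ :* a₄ :+ a₂ :* a₃ :* a₃ :- a₄ :* a₄

  disc[y²=x³-3sx+2t] : ∀ s t → Weierstrass.disc (weierstrass {R = k} 0# 0# 0# (- (ι k 3 * s)) (ι k 2 * t)) ≈
                       - (ι k 1728 * (t * t - s * s * s))
  disc[y²=x³-3sx+2t] = solve 2 (λ s t → discₚ (con (0 , 0)) (con (0 , 0)) (con (0 , 0)) (:- (con (3 , 0) :* s)) (con (2 , 0) :* t)
                                := :- (con (1728 , 0) :* (t :* t :- s :* s :* s))) refl

  disc[y²+xy=x³+t] : ∀ t → Weierstrass.disc (weierstrass {R = k} (ι k 1) 0# 0# 0# t) ≈ - t - ι k 432 * (t * t)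
  disc[y²+xy=x³+t] = solve 1 (λ t → discₚ (con (1 , 0)) (con (0 , 0)) (con (0 , 0)) (con (0 , 0)) t
                           := :- t :- con (432 , 0) :* (t :* t)) refl

module DiscriminantValues {r ℓ} (k : CommutativeRing r ℓ) (isField : IsField k) (finite : IsFinite k) where
  open CommutativeRing k
  open IsField isField using (1≉0)
  open IntegerCoefficientSolver k
  open Counting k finite using (_≟_)
  open FieldArithmetic k isField finite
  open Discriminants k
  open import Algebra.Properties.Ring ring using (-0#≈0#; -‿involutive)
  open import Relation.Binary.Reasoning.Setoid setoid

  HasDiscriminant : Carrier → Set _
  HasDiscriminant δ = ∃ λ (W : Weierstrass k) → Weierstrass.disc W ≈ δ

  has-discriminant-432≈0 : ι k 432 ≈ 0# → ∀ δ → HasDiscriminant δ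
  has-discriminant-432≈0 432≈0 δ = weierstrass {R = k} (ι k 1) 0# 0# 0# (- δ) , (begin
    Weierstrass.disc (weierstrass {R = k} (ι k 1) 0# 0# 0# (- δ))  ≈⟨ disc[y²+xy=x³+t] (- δ) ⟩
    - - δ - ι k 432 * (- δ * - δ)                           ≈⟨ +-congˡ (-‿cong (trans (*-congʳ 432≈0) (zeroˡ (- δ * - δ)))) ⟩
    - - δ - 0#                                              ≈⟨ trans (+-congˡ -0#≈0#) (+-identityʳ (- - δ)) ⟩
    - - δ                                                   ≈⟨ -‿involutive δ ⟩
    δ                                                       ∎)

  has-discriminant-2≉0-3≉0 : ¬ ι k 2 ≈ 0# → ¬ ι k 3 ≈ 0# → ∀ {δ} → ¬ δ ≈ 0# → HasDiscriminant δ
  has-discriminant-2≉0-3≉0 2≉0 3≉0 {δ} δ≉0 = from-point (has-point c≉0)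
    where
    open CurvePoints k isField finite 2≉0 using (HasPoint; has-point)
    1728≉0 : ¬ ι k 1728 ≈ 0#
    1728≉0 1728≈0 = nonzero-product (pow-nonzero 2≉0 6) (pow-nonzero 3≉0 3)
      (trans (solve 0 (con (2 , 0) :^ 6 :* con (3 , 0) :^ 3 := con (1728 , 0)) refl) 1728≈0)
    1728⁻¹ : Carrier
    1728⁻¹ = ι k 1728 ⁻¹⟨ 1728≉0 ⟩
    c : Carrier
    c = - (δ * 1728⁻¹)
    c≉0 : ¬ c ≈ 0#
    c≉0 c≈0 = nonzero-product δ≉0 (⁻¹-nonzero 1728≉0) (trans (sym (-‿involutive _)) (trans (-‿cong c≈0) -0#≈0#))
    from-point : HasPoint c → HasDiscriminant δ
    from-point (x , y , on-curve) = weierstrass {R = k} 0# 0# 0# (- (ι k 3 * x)) (ι k 2 * y) , (begin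
      Weierstrass.disc (weierstrass {R = k} 0# 0# 0# (- (ι k 3 * x)) (ι k 2 * y))  ≈⟨ disc[y²=x³-3sx+2t] x y ⟩
      - (ι k 1728 * (y * y - x * x * x))                                  ≈⟨ -‿cong (*-congˡ (+-congʳ on-curve)) ⟩
      - (ι k 1728 * (x * x * x + c - x * x * x))
        ≈⟨ solve 4 (λ a i δ x → :- (a :* (x :* x :* x :+ :- (δ :* i) :- x :* x :* x)) := (a :* i) :* δ) refl (ι k 1728) 1728⁻¹ δ x ⟩
      (ι k 1728 * 1728⁻¹) * δ                                             ≈⟨ *-congʳ (*-inverseʳ (ι k 1728) 1728≉0) ⟩
      1# * δ                                                              ≈⟨ *-identityˡ δ ⟩
      δ                                                                   ∎)

  nonzero-has-discriminant : ∀ {δ} → ¬ δ ≈ 0# → HasDiscriminant δ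
  nonzero-has-discriminant {δ} δ≉0 = by-characteristic (ι k 2 ≟ 0#) (ι k 3 ≟ 0#)
    where
    by-characteristic : Dec (ι k 2 ≈ 0#) → Dec (ι k 3 ≈ 0#) → HasDiscriminant δ
    by-characteristic (yes 2≈0) _ = has-discriminant-432≈0 (trans (ι-* 2 216) (trans (*-congʳ 2≈0) (zeroˡ (ι k 216)))) δ
    by-characteristic (no _) (yes 3≈0) = has-discriminant-432≈0 (trans (ι-* 3 144) (trans (*-congʳ 3≈0) (zeroˡ (ι k 144)))) δ
    by-characteristic (no 2≉0) (no 3≉0) = has-discriminant-2≉0-3≉0 2≉0 3≉0 δ≉0

  elliptic-curve-with-discriminant : ∀ {δ} → ¬ δ ≈ 0# → HasDiscriminant δ → ∃ λ (E : EllipticCurve k) → IsDiscriminantOf k δ E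
  elliptic-curve-with-discriminant {δ} δ≉0 (W , disc≈δ) =
    record { equation = W ; nonsingular = λ disc≈0 → δ≉0 (trans (sym disc≈δ) disc≈0) } ,
    1# , 1≉0 , trans disc≈δ (sym (trans (*-congˡ (pow-1# 12)) (*-identityʳ δ)))

corollary72 : ∀ {c ℓ} (k : CommutativeRing c ℓ) → IsField k → IsFinite k →
    ∀ (δ : CommutativeRing.Carrier k) → ¬ (CommutativeRing._≈_ k δ (CommutativeRing.0# k)) →
    ∃ λ (E : EllipticCurve k) → IsDiscriminantOf k δ E
corollary72 k isField finite δ δ≉0 = elliptic-curve-with-discriminant δ≉0 (nonzero-has-discriminant δ≉0)
  where open DiscriminantValues k isField finite
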